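{- Let $i_1, i_2 \in \mathbb{Q}$ with $0 \le i_1 \le i_2$, let $\kappa,\lambda\in\mathbb{Q}$ be positive, and let $A$ be any MTL formula. Then $$\boxplus_{[i_1,i_2]} A \;\equiv\; \Big(\Diamond^{+}_{[\frac{3i_1-i_2}{2},\, i_1]}\big(A\,\mathcal{U}_{[i_2-i_1,\, i_2-i_1+\kappa]}\,\top\big)\Big)\;\land\;\Big(\Diamond^{+}_{[i_2,\, \frac{3i_2-i_1}{2}]}\big(A\,\mathcal{S}_{[i_2-i_1,\, i_2-i_1+\lambda]}\,\top\big)\Big).$$
   Context: Metric Temporal Logic (MTL) over the rational timeline. Fix a set $\mathcal{P}$ of predicate symbols. A model is $M=(\mathbb{Q},<,V)$ where $V$ maps each time point $t\in\mathbb{Q}$ to a subset $V(t)\subseteq\mathcal{P}$. Formulae are given by $A ::= p \mid \top \mid \neg A \mid A\land A \mid \boxplus_I A \mid \boxminus_I A \mid \Diamond^{+}_I A \mid \Diamond^{ - }_I A \mid A\,\mathcal{S}_I\, A \mid A\,\mathcal{U}_I\, A$, where $p\in\mathcal{P}$ and $I=[a,b]$ ($a\le b$) is a closed bounded interval with rational endpoints. Semantics at time $t\in\mathbb{Q}$: $M,t\models p$ iff $p\in V(t)$; $M,t\models\top$ always; $\neg$ and $\land$ as usual; $M,t\models \Diamond^{ - }_I A$ iff $M,t'\models A$ for some $t'$ with $t-t'\in I$; $M,t\models \Diamond^{+}_I A$ iff $M,t'\models A$ for some $t'$ with $t'-t\in I$; $M,t\models\boxminus_I A$ iff $M,t'\models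 A$ for all $t'$ with $t-t'\in I$; $M,t\models\boxplus_I A$ iff $M,t'\models A$ for all $t'$ with $t'-t\in I$; $M,t\models A_1\,\mathcal{S}_I\,A_2$ iff there is $t'$ with $t-t'\in I$, $M,t'\models A_2$, and $M,t''\models A_1$ for all $t''\in[t',t]$; $M,t\models A_1\,\mathcal{U}_I\,A_2$ iff there is $t'$ with $t'-t\in I$, $M,t'\models A_2$, and $M,t''\models A_1$ for all $t''\in[t,t']$ (all time points range over $\mathbb{Q}$). Two formulae $A_1,A_2$ are equivalent, $A_1\equiv A_2$, iff for every model $M$ and every $t\in\mathbb{Q}$, $M,t\models A_1$ if and only if $M,t\models A_2$. -}

module Defs where

open import Level using (0ℓ)
open import Data.Product using (Σ; _×_; _,_)
open import Data.Unit using (⊤)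
open import Relation.Nullary using (¬_)
open import Data.Rational using (ℚ; _≤_; _-_)
open import Function.Bundles using (_⇔_)

record Interval : Set where
  constructor [_,_]⟨_⟩
  field
    lo : ℚ
    hi : ℚ
    lo≤hi : lo ≤ hi
open Interval public

_∈I_ : ℚ → Interval → Set
x ∈I I = (lo I ≤ x) × (x ≤ hi I)

data Formula (𝒫 : Set) : Set where
  pred  : 𝒫 → Formula 𝒫
  tt    : Formula 𝒫
  ¬'_   : Formula 𝒫 → Formula 𝒫
  _∧'_  : Formula 𝒫 → Formula 𝒫 → Formula 𝒫
  ⊞     : Interval → Formula 𝒫 → Formula 𝒫
  ⊟     : Interval → Formula 𝒫 → Formula 𝒫
  ◇⁺    : Interval → Formula 𝒫 → Formula 𝒫
  ◇⁻    : Interval → Formula 𝒫 → Formula 𝒫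
  Since : Interval → Formula 𝒫 → Formula 𝒫 → Formula 𝒫
  Until : Interval → Formula 𝒫 → Formula 𝒫 → Formula 𝒫

Model : Set → Set₁
Model 𝒫 = ℚ → 𝒫 → Set

_,_⊨_ : {𝒫 : Set} → Model 𝒫 → ℚ → Formula 𝒫 → Set
M , t ⊨ pred p = M t p
M , t ⊨ tt = ⊤
M , t ⊨ (¬' A) = ¬ (M , t ⊨ A)
M , t ⊨ (A ∧' B) = (M , t ⊨ A) × (M , t ⊨ B)
M , t ⊨ ⊞ I A = ∀ t' → (t' - t) ∈I I → M , t' ⊨ A
M , t ⊨ ⊟ I A = ∀ t' → (t - t') ∈I I → M , t' ⊨ A
M , t ⊨ ◇⁺ I A = Σ ℚ λ t' → ((t' - t) ∈I I) × (M , t' ⊨ A)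
M , t ⊨ ◇⁻ I A = Σ ℚ λ t' → ((t - t') ∈I I) × (M , t' ⊨ A)
M , t ⊨ Since I A₁ A₂ = Σ ℚ λ t' → ((t - t') ∈I I) × (M , t' ⊨ A₂)
                         × (∀ t'' → t' ≤ t'' → t'' ≤ t → M , t'' ⊨ A₁)
M , t ⊨ Until I A₁ A₂ = Σ ℚ λ t' → ((t' - t) ∈I I) × (M , t' ⊨ A₂)
                         × (∀ t'' → t ≤ t'' → t'' ≤ t' → M , t'' ⊨ A₁)

_≡MTL_ : {𝒫 : Set} → Formula 𝒫 → Formula 𝒫 → Set₁
_≡MTL_ {𝒫} A₁ A₂ = (M : Model 𝒫) (t : ℚ) → (M , t ⊨ A₁) ⇔ (M , t ⊨ A₂)

-- At t, ⊞_[i₁,i₂] A says that A holds throughout [t + i₁, t + i₂].  The left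
-- conjunct covers that window from its left end up to some point u: its
-- ◇⁺-witness lies at or after t + (3i₁ − i₂)/2, and the Until-witness is at
-- least i₂ − i₁ further on, so u ≥ t + (i₁ + i₂)/2.  Symmetrically the right
-- conjunct covers the window from some v ≤ t + (i₁ + i₂)/2 up to its right end.
-- The two pieces meet at the midpoint, so together they cover the window;
-- conversely the window itself provides the witnesses t + i₁ and t + i₂.
module Submission where

open import Defs
open import Data.Rational using (ℚ; _≤_; _<_; _+_; _-_; _*_; ½; 0ℚ; -_)
open import Data.Rational.Properties
  using (≤-refl; ≤-trans; +-comm; +-monoˡ-≤; _≤?_; ≰⇒>; <⇒≤; module ≤-Reasoning)
open import Data.Rational.Solver using (module +-*-Solver)
open import Data.Product using (_×_; _,_)
open import Data.Unit using (tt)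
open import Relation.Nullary using (yes; no)
open import Relation.Binary.PropositionalEquality using (_≡_; refl; sym; subst; subst₂)
open import Function.Bundles using (_⇔_; mk⇔; module Equivalence)

open +-*-Solver

private
  variable
    p q r t : ℚ

r+p-r≡p : ∀ r p → (r + p) - r ≡ p
r+p-r≡p = solve 2 (λ r p → (r :+ p) :- r := p) refl

[r+q]-[r+p]≡q-p : ∀ r p q → (r + q) - (r + p) ≡ q - p
[r+q]-[r+p]≡q-p = solve 3 (λ r p q → (r :+ q) :- (r :+ p) := q :- p) refl

p-r+r≡p : ∀ p r → (p - r) + r ≡ p
p-r+r≡p = solve 2 (λ p r → (p :- r) :+ r := p) refl

p≤q-r⇒r+p≤q : p ≤ q - r → r + p ≤ q
p≤q-r⇒r+p≤q {p} {q} {r} h = subst₂ _≤_ (+-comm p r) (p-r+r≡p q r) (+-monoˡ-≤ r h)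

r+p≤q⇒p≤q-r : r + p ≤ q → p ≤ q - r
r+p≤q⇒p≤q-r {r} {p} h = subst (_≤ _) (r+p-r≡p r p) (+-monoˡ-≤ (- r) h)

p-r≤q⇒p≤r+q : p - r ≤ q → p ≤ r + q
p-r≤q⇒p≤r+q {p} {r} {q} h = subst₂ _≤_ (p-r+r≡p p r) (+-comm q r) (+-monoˡ-≤ r h)

p≤r+q⇒p-r≤q : p ≤ r + q → p - r ≤ q
p≤r+q⇒p-r≤q {r = r} {q} h = subst (_ ≤_) (r+p-r≡p r q) (+-monoˡ-≤ (- r) h)

Throughout : (ℚ → Set) → ℚ → ℚ → Set
Throughout P a b = ∀ x → a ≤ x → x ≤ b → P x

module _ {P : ℚ → Set} {a b : ℚ} where

  Throughout-shrink : ∀ {a′ b′} → a′ ≤ a → b ≤ b′ → Throughout P a′ b′ → Throughout P a b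
  Throughout-shrink a′≤a b≤b′ h x a≤x x≤b = h x (≤-trans a′≤a a≤x) (≤-trans x≤b b≤b′)

  Throughout-join : ∀ c → Throughout P a c → Throughout P c b → Throughout P a b
  Throughout-join c left right x a≤x x≤b with x ≤? c
  ... | yes x≤c = left x a≤x x≤c
  ... | no x≰c = right x (<⇒≤ (≰⇒> x≰c)) x≤b

module Windows {𝒫 : Set} (M : Model 𝒫) (A : Formula 𝒫) where

  private
    ⟦A⟧ : ℚ → Set
    ⟦A⟧ x = M , x ⊨ A

  ⊞⇔Throughout : ∀ {I} t → (M , t ⊨ ⊞ I A) ⇔ Throughout ⟦A⟧ (t + lo I) (t + hi I)
  ⊞⇔Throughout t = mk⇔
    (λ h x l u → h x (r+p≤q⇒p≤q-r l , p≤r+q⇒p-r≤q u))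
    (λ h x (l , u) → h x (p≤q-r⇒r+p≤q l) (p-r≤q⇒p≤r+q u))

  module _ (I J K : Interval) where

    private
      shift-∈I : ∀ t → p ∈I J → ((t + p) - t) ∈I J
      shift-∈I {p} t = subst (_∈I J) (sym (r+p-r≡p t p))

      width-∈I : ∀ t → (hi I - lo I) ∈I K → ((t + hi I) - (t + lo I)) ∈I K
      width-∈I t = subst (_∈I K) (sym ([r+q]-[r+p]≡q-p t (lo I) (hi I)))

    ⊞⇒◇⁺Until : lo I ∈I J → (hi I - lo I) ∈I K →
                 M , t ⊨ ⊞ I A → M , t ⊨ ◇⁺ J (Until K A tt)
    ⊞⇒◇⁺Until {t} lo∈J width∈K h =
      t + lo I , shift-∈I t lo∈J , t + hi I , width-∈I t width∈K , tt ,
      Equivalence.to (⊞⇔Throughout {I} t) h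

    ⊞⇒◇⁺Since : hi I ∈I J → (hi I - lo I) ∈I K →
                 M , t ⊨ ⊞ I A → M , t ⊨ ◇⁺ J (Since K A tt)
    ⊞⇒◇⁺Since {t} hi∈J width∈K h =
      t + hi I , shift-∈I t hi∈J , t + lo I , width-∈I t width∈K , tt ,
      Equivalence.to (⊞⇔Throughout {I} t) h

  module _ (J K : Interval) where

    ◇⁺Until⇒Throughout : M , t ⊨ ◇⁺ J (Until K A tt) →
                          Throughout ⟦A⟧ (t + hi J) ((t + lo J) + lo K)
    ◇⁺Until⇒Throughout {t} (t₁ , (lo≤t₁-t , t₁-t≤hi) , u , (lo≤u-t₁ , _) , _ , A-on) =
      Throughout-shrink t₁≤t+hi t+lo+lo≤u A-on
      where
      open ≤-Reasoning
      t+lo≤t₁ : t + lo J ≤ t₁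
      t+lo≤t₁ = p≤q-r⇒r+p≤q lo≤t₁-t
      t₁≤t+hi : t₁ ≤ t + hi J
      t₁≤t+hi = p-r≤q⇒p≤r+q t₁-t≤hi
      t+lo+lo≤u : (t + lo J) + lo K ≤ u
      t+lo+lo≤u = begin
        (t + lo J) + lo K  ≤⟨ +-monoˡ-≤ (lo K) t+lo≤t₁ ⟩
        t₁ + lo K          ≤⟨ p≤q-r⇒r+p≤q lo≤u-t₁ ⟩
        u                  ∎

    ◇⁺Since⇒Throughout : M , t ⊨ ◇⁺ J (Since K A tt) →
                          Throughout ⟦A⟧ ((t + hi J) - lo K) (t + lo J)
    ◇⁺Since⇒Throughout {t} (s , (lo≤s-t , s-t≤hi) , v , (lo≤s-v , _) , _ , A-on) =
      Throughout-shrink v≤t+hi-lo t+lo≤s A-on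
      where
      open ≤-Reasoning
      t+lo≤s : t + lo J ≤ s
      t+lo≤s = p≤q-r⇒r+p≤q lo≤s-t
      v≤t+hi-lo : v ≤ (t + hi J) - lo K
      v≤t+hi-lo = r+p≤q⇒p≤q-r (begin
        lo K + v  ≡⟨ +-comm (lo K) v ⟩
        v + lo K  ≤⟨ p≤q-r⇒r+p≤q lo≤s-v ⟩
        s         ≤⟨ p-r≤q⇒p≤r+q s-t≤hi ⟩
        t + hi J  ∎)

midpoint : ∀ t i₁ i₂ → (t + (i₁ + i₁ + i₁ - i₂) * ½) + (i₂ - i₁)
                       ≡ (t + (i₂ + i₂ + i₂ - i₁) * ½) - (i₂ - i₁)
midpoint = solve 3 (λ t i₁ i₂ → (t :+ (i₁ :+ i₁ :+ i₁ :- i₂) :* con ½) :+ (i₂ :- i₁)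
                               := (t :+ (i₂ :+ i₂ :+ i₂ :- i₁) :* con ½) :- (i₂ :- i₁)) refl

theorem3 : {𝒫 : Set} (i₁ i₂ κ λ' : ℚ) → 0ℚ ≤ i₁ → i₁ ≤ i₂ → 0ℚ < κ → 0ℚ < λ'
    → (A : Formula 𝒫)
    → (p₀ : i₁ ≤ i₂)
    → (p₁ : (i₁ + i₁ + i₁ - i₂) * ½ ≤ i₁)
    → (p₂ : i₂ - i₁ ≤ i₂ - i₁ + κ)
    → (p₃ : i₂ ≤ (i₂ + i₂ + i₂ - i₁) * ½)
    → (p₄ : i₂ - i₁ ≤ i₂ - i₁ + λ')
    → ⊞ [ i₁ , i₂ ]⟨ p₀ ⟩ A
      ≡MTL
      ((◇⁺ [ (i₁ + i₁ + i₁ - i₂) * ½ , i₁ ]⟨ p₁ ⟩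
           (Until [ i₂ - i₁ , i₂ - i₁ + κ ]⟨ p₂ ⟩ A tt))
       ∧'
       (◇⁺ [ i₂ , (i₂ + i₂ + i₂ - i₁) * ½ ]⟨ p₃ ⟩
           (Since [ i₂ - i₁ , i₂ - i₁ + λ' ]⟨ p₄ ⟩ A tt)))
theorem3 i₁ i₂ κ λ' _ _ _ _ A p₀ p₁ p₂ p₃ p₄ M t = mk⇔
  (λ h → ⊞⇒◇⁺Until I J⁻ K⁻ (p₁ , ≤-refl) (≤-refl , p₂) h ,
         ⊞⇒◇⁺Since I J⁺ K⁺ (≤-refl , p₃) (≤-refl , p₄) h)
  (λ (left , right) → Equivalence.from (⊞⇔Throughout {I} t)
     (Throughout-join _ (◇⁺Until⇒Throughout J⁻ K⁻ left)
       (subst (λ c → Throughout _ c (t + i₂)) (sym (midpoint t i₁ i₂))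
              (◇⁺Since⇒Throughout J⁺ K⁺ right))))
  where
  open Windows M A
  I J⁻ K⁻ J⁺ K⁺ : Interval
  I = [ i₁ , i₂ ]⟨ p₀ ⟩
  J⁻ = [ (i₁ + i₁ + i₁ - i₂) * ½ , i₁ ]⟨ p₁ ⟩
  K⁻ = [ i₂ - i₁ , i₂ - i₁ + κ ]⟨ p₂ ⟩
  J⁺ = [ i₂ , (i₂ + i₂ + i₂ - i₁) * ½ ]⟨ p₃ ⟩
  K⁺ = [ i₂ - i₁ , i₂ - i₁ + λ' ]⟨ p₄ ⟩
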